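{- The problem (2-SPNI) is intractable, even on two-terminal series-parallel graphs and even with unit interdiction costs ($c(a)=1$ for all $a\in A$): there exist instances for which the number of non-dominated points is exponential in the size of the instance.
   Context: An instance $(G,l,c,B)$ of (2-SPNI) consists of a directed network (multiple parallel arcs allowed) $G=(V,A)$ with source $s$ and sink $t$, lengths $l=(l^1,l^2):A\to\mathbb{N}^2$, interdiction costs $c:A\to\mathbb{N}$ and budget $B\in\mathbb{N}$. Feasible strategies: $\Gamma=\{\gamma\in\{0,1\}^A:\sum_a c(a)\gamma_a\leq B\}$; $G(\gamma)$ is $G$ with the arcs $a$ having $\gamma_a=1$ removed. For $\gamma\in\Gamma$, $f_G(\gamma)=(f^1_G(\gamma),f^2_G(\gamma))$ where $f^i_G(\gamma)$ is the minimum of $l^i(P)=\sum_{a\in P}l^i(a)$ over all $s$-$t$-paths $P$ in $G(\gamma)$ ($\infty$ if none). The Pareto order: $y_1\geq y_2$ iff $y_1^k\geq y_2^k$ for $k=1,2$ and $y_1\neq y_2$. A strategy $\gamma\in\Gamma$ is efficient if no $\gamma'\in\Gamma$ has $f_G(\gamma')\geq f_G(\gamma)$; then $f_G(\gamma)$ is a non-dominated point. A directed graph is two-terminal series-parallel with source $s$ and sink $t$ if it can be built from single-arc graphs $(s,t)$ by repeated parallel compositions (identifying sources and identifying sinks of two such graphs) and series compositions (identifying the sink of the first with the source of the second). -}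

module Defs where

open import Data.Nat using (ℕ; zero; suc; _+_; _*_; _≤_)
open import Data.Nat.Logarithm using (⌊log₂_⌋)
open import Data.Fin using (Fin; zero; suc; _↑ˡ_; _↑ʳ_; splitAt)
open import Data.Bool using (Bool; true; false)
open import Data.Maybe using (Maybe; just; nothing)
open import Data.Sum using (_⊎_; inj₁; inj₂)
open import Data.Product using (Σ; ∃; _×_; _,_)
open import Data.List using (List; []; _∷_; _++_; map; tabulate; length)
open import Data.Nat.ListAction using (sum)
open import Data.List.Relation.Unary.All using (All)
open import Data.List.Relation.Unary.Unique.Propositional using (Unique)
open import Data.Empty using (⊥)
open import Data.Unit using (⊤)
open import Relation.Nullary using (¬_)
open import Relation.Binary.PropositionalEquality using (_≡_; _≢_)
open import Function.Definitions using (Bijective)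

-- Instances (G, l, c, B) of 2-SPNI.
-- Vertices are Fin nV, arcs are Fin m (parallel arcs allowed: arcs are
-- named, each with its own tail and head).

record Instance : Set where
  field
    nV   : ℕ
    m    : ℕ
    tail : Fin m → Fin nV
    head : Fin m → Fin nV
    s    : Fin nV
    t    : Fin nV
    l¹   : Fin m → ℕ
    l²   : Fin m → ℕ
    c    : Fin m → ℕ
    B    : ℕ

open Instance public

sumA : (I : Instance) → (Fin (m I) → ℕ) → ℕ
sumA I f = sum (tabulate f)

-- Strategies: γ ∈ {0,1}^A (true = arc interdicted), feasible if within budget.

Strategy : Instance → Set
Strategy I = Fin (m I) → Bool

b2n : Bool → ℕ
b2n true  = 1
b2n false = 0

Feasible : (I : Instance) → Strategy I → Set
Feasible I γ = sumA I (λ a → c I a * b2n (γ a)) ≤ B I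

data Walk (I : Instance) (u : Fin (nV I)) : Fin (nV I) → Set where
  nil  : Walk I u u
  snoc : ∀ {v} → Walk I u v → (a : Fin (m I)) → tail I a ≡ v → Walk I u (head I a)

walkVertices : ∀ {I u v} → Walk I u v → List (Fin (nV I))
walkVertices {u = u} nil = u ∷ []
walkVertices {I = I} (snoc p a _) = walkVertices p ++ (head I a ∷ [])

walkArcs : ∀ {I u v} → Walk I u v → List (Fin (m I))
walkArcs nil = []
walkArcs (snoc p a _) = walkArcs p ++ (a ∷ [])

record Path (I : Instance) (γ : Strategy I) : Set where
  field
    walk   : Walk I (s I) (t I)
    simple : Unique (walkVertices walk)
    avoids : All (λ a → γ a ≡ false) (walkArcs walk)

open Path public

pathLength : (I : Instance) → (Fin (m I) → ℕ) → ∀ {γ} → Path I γ → ℕ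
pathLength I l P = sum (map l (walkArcs (walk P)))

-- Values in ℕ ∪ {∞}: nothing = ∞.

ℕ∞ : Set
ℕ∞ = Maybe ℕ

_≤∞_ : ℕ∞ → ℕ∞ → Set
_        ≤∞ nothing = ⊤
nothing  ≤∞ just _  = ⊥
just x   ≤∞ just y  = x ≤ y

IsMinLength : (I : Instance) → (Fin (m I) → ℕ) → Strategy I → ℕ∞ → Set
IsMinLength I l γ nothing  = ¬ Path I γ
IsMinLength I l γ (just d) =
  (Σ (Path I γ) λ P → pathLength I l P ≡ d) × ((P : Path I γ) → d ≤ pathLength I l P)

Point : Set
Point = ℕ∞ × ℕ∞

ObjVal : (I : Instance) → Strategy I → Point → Set
ObjVal I γ (y₁ , y₂) = IsMinLength I (l¹ I) γ y₁ × IsMinLength I (l² I) γ y₂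

_≥P_ : Point → Point → Set
(y₁ , y₂) ≥P (y₁' , y₂') = (y₁' ≤∞ y₁) × (y₂' ≤∞ y₂) × ((y₁ , y₂) ≢ (y₁' , y₂'))

Efficient : (I : Instance) → Strategy I → Set
Efficient I γ = Feasible I γ ×
  ((γ' : Strategy I) → Feasible I γ' → ∀ y y' → ObjVal I γ y → ObjVal I γ' y' → ¬ (y' ≥P y))

NonDominated : Instance → Point → Set
NonDominated I y = Σ (Strategy I) λ γ → Efficient I γ × ObjVal I γ y

UnitCosts : Instance → Set
UnitCosts I = (a : Fin (m I)) → c I a ≡ 1

-- Two-terminal series-parallel graphs.
-- SP terms; the graph of a term has vertices Fin (2 + inner T), with
-- source zero, sink (suc zero), the rest internal; arcs Fin (narcs T).

data SP : Set where
  single : SP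
  par    : SP → SP → SP
  ser    : SP → SP → SP

inner : SP → ℕ
inner single    = 0
inner (par G H) = inner G + inner H
inner (ser G H) = suc (inner G + inner H)

narcs : SP → ℕ
narcs single    = 1
narcs (par G H) = narcs G + narcs H
narcs (ser G H) = narcs G + narcs H

SPV : SP → Set
SPV T = Fin (suc (suc (inner T)))

parL : ∀ G H → SPV G → SPV (par G H)
parL G H zero = zero
parL G H (suc zero) = suc zero
parL G H (suc (suc i)) = suc (suc (i ↑ˡ inner H))

parR : ∀ G H → SPV H → SPV (par G H)
parR G H zero = zero
parR G H (suc zero) = suc zero
parR G H (suc (suc j)) = suc (suc (inner G ↑ʳ j))

-- vertex embeddings for series composition (sink of G = source of H = mid)
mid : ∀ G H → SPV (ser G H)
mid G H = suc (suc zero)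

serL : ∀ G H → SPV G → SPV (ser G H)
serL G H zero = zero
serL G H (suc zero) = mid G H
serL G H (suc (suc i)) = suc (suc (suc (i ↑ˡ inner H)))

serR : ∀ G H → SPV H → SPV (ser G H)
serR G H zero = mid G H
serR G H (suc zero) = suc zero
serR G H (suc (suc j)) = suc (suc (suc (inner G ↑ʳ j)))

spTail spHead : (T : SP) → Fin (narcs T) → SPV T
spTail single _ = zero
spTail (par G H) a with splitAt (narcs G) a
... | inj₁ b = parL G H (spTail G b)
... | inj₂ b = parR G H (spTail H b)
spTail (ser G H) a with splitAt (narcs G) a
... | inj₁ b = serL G H (spTail G b)
... | inj₂ b = serR G H (spTail H b)
spHead single _ = suc zero
spHead (par G H) a with splitAt (narcs G) a
... | inj₁ b = parL G H (spHead G b)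
... | inj₂ b = parR G H (spHead H b)
spHead (ser G H) a with splitAt (narcs G) a
... | inj₁ b = serL G H (spHead G b)
... | inj₂ b = serR G H (spHead H b)

IsSeriesParallel : Instance → Set
IsSeriesParallel I =
  Σ SP λ T →
  Σ (Fin (nV I) → SPV T) λ φ →
  Σ (Fin (m I) → Fin (narcs T)) λ ψ →
    Bijective _≡_ _≡_ φ × Bijective _≡_ _≡_ ψ ×
    φ (s I) ≡ zero × φ (t I) ≡ suc zero ×
    ((a : Fin (m I)) → φ (tail I a) ≡ spTail T (ψ a) × φ (head I a) ≡ spHead T (ψ a))

bitLength : ℕ → ℕ
bitLength n = suc ⌊log₂ n ⌋

size : Instance → ℕ
size I = nV I + m I
       + sumA I (λ a → bitLength (l¹ I a) + bitLength (l² I a) + bitLength (c I a))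
       + bitLength (B I)

AtLeastNonDominated : Instance → ℕ → Set
AtLeastNonDominated I k =
  Σ (List Point) λ ys → Unique ys × All (NonDominated I) ys × k ≤ length ys

-- The instance for n is a series composition of 2n + 1 bundles, each consisting of n + 1
-- parallel arcs: a bypass of length (0, 0) and n copies of an arc of length λ.  With budget n
-- some arc of every bundle survives, so a shortest path crosses a bundle at length 0 if its
-- bypass survives and at length λ otherwise; a potential function shows that no path does
-- better, hence f(γ) is the sum of the λ of the bundles whose bypass γ interdicts.  Bit p owns
-- two bundles, with λ = (2^p, 2^n − 2^p) and λ = (0, 2^n); interdicting exactly one bypass of
-- each pair realises (k, n 2^n − k) for every k < 2^n.  As both coordinates of every λ sum to
-- at most 2^n, each feasible γ has f¹ + f² ≤ n 2^n, so these points are non-dominated.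

module Submission where

open import Defs
open import Data.Nat using (ℕ; zero; suc; _+_; _*_; _∸_; _^_; _≤_; _<_; _<?_; z≤n; s≤s)
open import Data.Nat.Properties
open import Data.Nat.Logarithm using (⌊log₂_⌋; ⌊log₂⌋-mono-≤; ⌊log₂[2^n]⌋≡n)
open import Data.Nat.ListAction using (sum)
open import Data.Nat.ListAction.Properties using (sum-++)
open import Data.Nat.Solver using (module +-*-Solver)
open import Data.Fin using (Fin; zero; suc; _↑ˡ_; _↑ʳ_; splitAt)
open import Data.Fin.Properties using (splitAt-↑ˡ; splitAt-↑ʳ; splitAt⁻¹-↑ˡ; splitAt⁻¹-↑ʳ)
open import Data.Bool using (Bool; true; false; not)
open import Data.Maybe using (just; nothing)
open import Data.Maybe.Properties using (just-injective)
open import Data.Sum using (inj₁; inj₂; [_,_]′)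
open import Data.Product using (Σ; _×_; _,_; proj₁; proj₂)
open import Data.List using (List; []; _∷_; _++_; map; tabulate; length; applyUpTo)
open import Data.List.Properties using (map-++; ++-assoc; ++-identityʳ; tabulate-cong; length-applyUpTo)
open import Data.List.Relation.Unary.All as All using (All; []; _∷_)
import Data.List.Relation.Unary.All.Properties as All
open import Data.List.Relation.Unary.AllPairs using ([]; _∷_)
open import Data.List.Relation.Unary.Unique.Propositional using (Unique)
import Data.List.Relation.Unary.Unique.Propositional.Properties as Unique
open import Data.Empty using (⊥-elim)
open import Relation.Nullary using (¬_; yes; no)
open import Relation.Binary.PropositionalEquality
open import Algebra.Properties.CommutativeSemigroup +-commutativeSemigroup using (interchange)
open import Function using (id)
open import Function.Definitions using (Bijective)

open +-*-Solver

sum-map-∷ʳ : ∀ {A : Set} (f : A → ℕ) xs x → sum (map f (xs ++ x ∷ [])) ≡ sum (map f xs) + f x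
sum-map-∷ʳ f xs x = begin
  sum (map f (xs ++ x ∷ []))       ≡⟨ cong sum (map-++ f xs (x ∷ [])) ⟩
  sum (map f xs ++ f x ∷ [])       ≡⟨ sum-++ (map f xs) (f x ∷ []) ⟩
  sum (map f xs) + (f x + 0)       ≡⟨ cong (sum (map f xs) +_) (+-identityʳ (f x)) ⟩
  sum (map f xs) + f x             ∎
  where open ≡-Reasoning

sum-map-∘ : ∀ {A B : Set} (f : B → ℕ) (g : A → B) (h : A → ℕ) → (∀ x → f (g x) ≡ h x) →
  ∀ xs → sum (map f (map g xs)) ≡ sum (map h xs)
sum-map-∘ f g h eq [] = refl
sum-map-∘ f g h eq (x ∷ xs) = cong₂ _+_ (eq x) (sum-map-∘ f g h eq xs)

Unique-∷ʳ : ∀ {A : Set} {xs : List A} {y} → Unique xs → All (_≢ y) xs → Unique (xs ++ y ∷ [])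
Unique-∷ʳ {xs = []} _ _ = [] ∷ []
Unique-∷ʳ {xs = x ∷ xs} (x∉xs ∷ u) (x≢y ∷ ys≢y) = All.++⁺ x∉xs (x≢y ∷ []) ∷ Unique-∷ʳ u ys≢y

IsPotential : (I : Instance) → (Fin (nV I) → ℕ) → (Fin (m I) → ℕ) → Strategy I → Set
IsPotential I π l γ = ∀ a → γ a ≡ false → π (head I a) ≤ π (tail I a) + l a

IsRank : (I : Instance) → (Fin (nV I) → ℕ) → Set
IsRank I ρ = ∀ a → ρ (tail I a) < ρ (head I a)

module _ {I : Instance} where

  snoc≡ : ∀ {u v w} → Walk I u v → (a : Fin (m I)) → tail I a ≡ v → head I a ≡ w → Walk I u w
  snoc≡ p a e refl = snoc p a e

  walkArcs-snoc≡ : ∀ {u v w} (p : Walk I u v) a e (h : head I a ≡ w) →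
    walkArcs (snoc≡ p a e h) ≡ walkArcs p ++ a ∷ []
  walkArcs-snoc≡ p a e refl = refl

  _++ʷ_ : ∀ {u v w} → Walk I u v → Walk I v w → Walk I u w
  p ++ʷ nil = p
  p ++ʷ snoc q a e = snoc (p ++ʷ q) a e

  walkArcs-++ʷ : ∀ {u v w} (p : Walk I u v) (q : Walk I v w) → walkArcs (p ++ʷ q) ≡ walkArcs p ++ walkArcs q
  walkArcs-++ʷ p nil = sym (++-identityʳ _)
  walkArcs-++ʷ p (snoc q a e) =
    trans (cong (_++ a ∷ []) (walkArcs-++ʷ p q)) (++-assoc (walkArcs p) (walkArcs q) _)

  potential-bound : (π : Fin (nV I) → ℕ) (l : Fin (m I) → ℕ) (γ : Strategy I) → IsPotential I π l γ →
    ∀ {u v} (w : Walk I u v) → All (λ a → γ a ≡ false) (walkArcs w) → π v ≤ π u + sum (map l (walkArcs w))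
  potential-bound π l γ isPotential nil _ = m≤m+n _ 0
  potential-bound π l γ isPotential {u} (snoc {v} p a refl) avoids = begin
    π (head I a)                            ≤⟨ isPotential a (All.head (All.++⁻ʳ (walkArcs p) avoids)) ⟩
    π v + l a
      ≤⟨ +-monoˡ-≤ (l a) (potential-bound π l γ isPotential p (All.++⁻ˡ (walkArcs p) avoids)) ⟩
    π u + sum (map l (walkArcs p)) + l a    ≡⟨ +-assoc (π u) _ _ ⟩
    π u + (sum (map l (walkArcs p)) + l a)  ≡⟨ cong (π u +_) (sum-map-∷ʳ l (walkArcs p) a) ⟨
    π u + sum (map l (walkArcs p ++ a ∷ [])) ∎
    where open ≤-Reasoning

  increasingRank⇒unique : (ρ : Fin (nV I) → ℕ) → IsRank I ρ →
    ∀ {u v} (w : Walk I u v) → Unique (walkVertices w)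
  increasingRank⇒unique ρ increasing w = proj₁ (unique-below w)
    where
    unique-below : ∀ {u v} (w : Walk I u v) → Unique (walkVertices w) × All (λ x → ρ x ≤ ρ v) (walkVertices w)
    unique-below nil = [] ∷ [] , ≤-refl ∷ []
    unique-below (snoc {v} p a refl) =
      let (unique , below) = unique-below p
          v<head = increasing a
      in Unique-∷ʳ unique (All.map (λ x≤v x≡head → <⇒≱ v<head (subst (λ x → ρ x ≤ ρ v) x≡head x≤v)) below)
       , All.++⁺ (All.map (λ x≤v → ≤-trans x≤v (<⇒≤ v<head)) below) (≤-refl ∷ [])

IsMinLength-functional : ∀ I l γ {y y'} → IsMinLength I l γ y → IsMinLength I l γ y' → y ≡ y'
IsMinLength-functional I l γ {nothing} {nothing} _ _ = refl
IsMinLength-functional I l γ {nothing} {just _} noPath ((P , _) , _) = ⊥-elim (noPath P)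
IsMinLength-functional I l γ {just _} {nothing} ((P , _) , _) noPath = ⊥-elim (noPath P)
IsMinLength-functional I l γ {just d} {just d'} ((P , refl) , d≤) ((P' , refl) , d'≤) =
  cong just (≤-antisym (d≤ P') (d'≤ P))

maxSum-undominated : ∀ {x y x' y' S} → x' + y' ≤ S → x + y ≡ S → ¬ ((just x' , just y') ≥P (just x , just y))
maxSum-undominated {x} {y} {x'} {y'} bound refl (x≤x' , y≤y' , distinct) =
  distinct (cong₂ (λ p q → just p , just q) (≤-antisym x'≤x x≤x') (≤-antisym y'≤y y≤y'))
  where
  x'≤x : x' ≤ x
  x'≤x = +-cancelʳ-≤ y x' x (≤-trans (+-monoʳ-≤ x' y≤y') bound)
  y'≤y : y' ≤ y
  y'≤y = +-cancelˡ-≤ x y' y (≤-trans (+-monoˡ-≤ y' x≤x') bound)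

↑-elim : ∀ {m n} (P : Fin (m + n) → Set) → (∀ i → P (i ↑ˡ n)) → (∀ j → P (m ↑ʳ j)) → ∀ k → P k
↑-elim {m} P left right k with splitAt m k in eq
... | inj₁ i = subst P (splitAt⁻¹-↑ˡ eq) (left i)
... | inj₂ j = subst P (splitAt⁻¹-↑ʳ eq) (right j)

spNetwork : (T : SP) → (Fin (narcs T) → ℕ × ℕ) → ℕ → Instance
spNetwork T lengths budget = record
  { nV = suc (suc (inner T)) ; m = narcs T ; tail = spTail T ; head = spHead T ; s = zero ; t = suc zero
  ; l¹ = λ a → proj₁ (lengths a) ; l² = λ a → proj₂ (lengths a) ; c = λ _ → 1 ; B = budget }

spGraph : SP → Instance
spGraph T = spNetwork T (λ _ → 0 , 0) 0

module _ (T : SP) (lengths : Fin (narcs T) → ℕ × ℕ) (budget : ℕ) where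

  fromSpGraph : ∀ {u v} → Walk (spGraph T) u v → Walk (spNetwork T lengths budget) u v
  fromSpGraph nil = nil
  fromSpGraph (snoc w a e) = snoc (fromSpGraph w) a e

  walkArcs-fromSpGraph : ∀ {u v} (w : Walk (spGraph T) u v) → walkArcs (fromSpGraph w) ≡ walkArcs w
  walkArcs-fromSpGraph nil = refl
  walkArcs-fromSpGraph (snoc w a e) = cong (_++ a ∷ []) (walkArcs-fromSpGraph w)

module Series (G H : SP) where

  spTail-↑ˡ : ∀ a → spTail (ser G H) (a ↑ˡ narcs H) ≡ serL G H (spTail G a)
  spTail-↑ˡ a rewrite splitAt-↑ˡ (narcs G) a (narcs H) = refl

  spHead-↑ˡ : ∀ a → spHead (ser G H) (a ↑ˡ narcs H) ≡ serL G H (spHead G a)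
  spHead-↑ˡ a rewrite splitAt-↑ˡ (narcs G) a (narcs H) = refl

  spTail-↑ʳ : ∀ b → spTail (ser G H) (narcs G ↑ʳ b) ≡ serR G H (spTail H b)
  spTail-↑ʳ b rewrite splitAt-↑ʳ (narcs G) (narcs H) b = refl

  spHead-↑ʳ : ∀ b → spHead (ser G H) (narcs G ↑ʳ b) ≡ serR G H (spHead H b)
  spHead-↑ʳ b rewrite splitAt-↑ʳ (narcs G) (narcs H) b = refl

  embedL : ∀ {u v} → Walk (spGraph G) u v → Walk (spGraph (ser G H)) (serL G H u) (serL G H v)
  embedL nil = nil
  embedL (snoc w a e) = snoc≡ (embedL w) (a ↑ˡ narcs H) (trans (spTail-↑ˡ a) (cong (serL G H) e)) (spHead-↑ˡ a)

  embedR : ∀ {u v} → Walk (spGraph H) u v → Walk (spGraph (ser G H)) (serR G H u) (serR G H v)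
  embedR nil = nil
  embedR (snoc w b e) = snoc≡ (embedR w) (narcs G ↑ʳ b) (trans (spTail-↑ʳ b) (cong (serR G H) e)) (spHead-↑ʳ b)

  walkArcs-embedL : ∀ {u v} (w : Walk (spGraph G) u v) → walkArcs (embedL w) ≡ map (_↑ˡ narcs H) (walkArcs w)
  walkArcs-embedL nil = refl
  walkArcs-embedL (snoc w a e) = begin
    walkArcs (embedL (snoc w a e))                    ≡⟨ walkArcs-snoc≡ (embedL w) _ _ (spHead-↑ˡ a) ⟩
    walkArcs (embedL w) ++ (a ↑ˡ narcs H) ∷ []        ≡⟨ cong (_++ _) (walkArcs-embedL w) ⟩
    map (_↑ˡ narcs H) (walkArcs w) ++ (a ↑ˡ narcs H) ∷ [] ≡⟨ map-++ _ (walkArcs w) (a ∷ []) ⟨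
    map (_↑ˡ narcs H) (walkArcs w ++ a ∷ [])          ∎
    where open ≡-Reasoning

  walkArcs-embedR : ∀ {u v} (w : Walk (spGraph H) u v) → walkArcs (embedR w) ≡ map (narcs G ↑ʳ_) (walkArcs w)
  walkArcs-embedR nil = refl
  walkArcs-embedR (snoc w b e) = begin
    walkArcs (embedR (snoc w b e))                    ≡⟨ walkArcs-snoc≡ (embedR w) _ _ (spHead-↑ʳ b) ⟩
    walkArcs (embedR w) ++ (narcs G ↑ʳ b) ∷ []        ≡⟨ cong (_++ _) (walkArcs-embedR w) ⟩
    map (narcs G ↑ʳ_) (walkArcs w) ++ (narcs G ↑ʳ b) ∷ [] ≡⟨ map-++ _ (walkArcs w) (b ∷ []) ⟨
    map (narcs G ↑ʳ_) (walkArcs w ++ b ∷ [])          ∎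
    where open ≡-Reasoning

  potential : (SPV G → ℕ) → (SPV H → ℕ) → SPV (ser G H) → ℕ
  potential p q zero = p zero
  potential p q (suc zero) = p (suc zero) + q (suc zero)
  potential p q (suc (suc zero)) = p (suc zero)
  potential p q (suc (suc (suc i))) =
    [ (λ i → p (suc (suc i))) , (λ j → p (suc zero) + q (suc (suc j))) ]′ (splitAt (inner G) i)

  potential-serL : ∀ p q v → potential p q (serL G H v) ≡ p v
  potential-serL p q zero = refl
  potential-serL p q (suc zero) = refl
  potential-serL p q (suc (suc i)) rewrite splitAt-↑ˡ (inner G) i (inner H) = refl

  potential-serR : ∀ p q → q zero ≡ 0 → ∀ w → potential p q (serR G H w) ≡ p (suc zero) + q w
  potential-serR p q q₀ zero rewrite q₀ = sym (+-identityʳ _)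
  potential-serR p q q₀ (suc zero) = refl
  potential-serR p q q₀ (suc (suc j)) rewrite splitAt-↑ʳ (inner G) (inner H) j = refl

  potential-isPotential : ∀ {p q} {lG lH} (l : Fin (narcs (ser G H)) → ℕ) (γ : Fin (narcs (ser G H)) → Bool) →
    q zero ≡ 0 → (∀ b → l (b ↑ˡ narcs H) ≡ lG b) → (∀ b → l (narcs G ↑ʳ b) ≡ lH b) →
    IsPotential (spGraph G) p lG (λ b → γ (b ↑ˡ narcs H)) → IsPotential (spGraph H) q lH (λ b → γ (narcs G ↑ʳ b)) →
    IsPotential (spGraph (ser G H)) (potential p q) l γ
  potential-isPotential {p} {q} {lG} {lH} l γ q₀ l≡lG l≡lH potG potH = ↑-elim _ left right
    where
    left : ∀ b → γ (b ↑ˡ narcs H) ≡ false →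
      potential p q (spHead (ser G H) (b ↑ˡ narcs H)) ≤ potential p q (spTail (ser G H) (b ↑ˡ narcs H)) + l (b ↑ˡ narcs H)
    left b isOpen rewrite spHead-↑ˡ b | spTail-↑ˡ b | potential-serL p q (spHead G b) | potential-serL p q (spTail G b)
                        | l≡lG b = potG b isOpen
    right : ∀ b → γ (narcs G ↑ʳ b) ≡ false →
      potential p q (spHead (ser G H) (narcs G ↑ʳ b)) ≤ potential p q (spTail (ser G H) (narcs G ↑ʳ b)) + l (narcs G ↑ʳ b)
    right b isOpen rewrite spHead-↑ʳ b | spTail-↑ʳ b | potential-serR p q q₀ (spHead H b) | potential-serR p q q₀ (spTail H b)
                         | l≡lH b | +-assoc (p (suc zero)) (q (spTail H b)) (lH b) = +-monoʳ-≤ (p (suc zero)) (potH b isOpen)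

  potential-isRank : ∀ {p q} → q zero ≡ 0 →
    IsRank (spGraph G) p → IsRank (spGraph H) q → IsRank (spGraph (ser G H)) (potential p q)
  potential-isRank {p} {q} q₀ rankG rankH = ↑-elim _ left right
    where
    left : ∀ b → potential p q (spTail (ser G H) (b ↑ˡ narcs H)) < potential p q (spHead (ser G H) (b ↑ˡ narcs H))
    left b rewrite spHead-↑ˡ b | spTail-↑ˡ b | potential-serL p q (spHead G b) | potential-serL p q (spTail G b) = rankG b
    right : ∀ b → potential p q (spTail (ser G H) (narcs G ↑ʳ b)) < potential p q (spHead (ser G H) (narcs G ↑ʳ b))
    right b rewrite spHead-↑ʳ b | spTail-↑ʳ b | potential-serR p q q₀ (spHead H b) | potential-serR p q q₀ (spTail H b) =
      +-monoʳ-< (p (suc zero)) (rankH b)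

count : ∀ {n} → (Fin n → Bool) → ℕ
count γ = sum (tabulate (λ a → b2n (γ a)))

count-cong : ∀ {n} {γ δ : Fin n → Bool} → (∀ a → γ a ≡ δ a) → count γ ≡ count δ
count-cong eq = cong sum (tabulate-cong (λ a → cong b2n (eq a)))

count-false : ∀ n → count {n} (λ _ → false) ≡ 0
count-false zero = refl
count-false (suc n) = count-false n

tabulate-++ : ∀ {A : Set} m n (f : Fin (m + n) → A) →
  tabulate f ≡ tabulate (λ i → f (i ↑ˡ n)) ++ tabulate (λ j → f (m ↑ʳ j))
tabulate-++ zero n f = refl
tabulate-++ (suc m) n f = cong (f zero ∷_) (tabulate-++ m n (λ i → f (suc i)))

count-++ : ∀ m n (γ : Fin (m + n) → Bool) → count γ ≡ count (λ i → γ (i ↑ˡ n)) + count (λ j → γ (m ↑ʳ j))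
count-++ m n γ = trans (cong sum (tabulate-++ m n (λ a → b2n (γ a)))) (sum-++ (tabulate (λ i → b2n (γ (i ↑ˡ n)))) _)

count<⇒false : ∀ {n} (γ : Fin n → Bool) → count γ < n → Σ (Fin n) λ a → γ a ≡ false
count<⇒false {suc n} γ count<n with γ zero in eq
... | false = zero , eq
... | true with count<⇒false (λ a → γ (suc a)) (≤-pred count<n)
...   | a , γa = suc a , γa

coord : Bool → ℕ × ℕ → ℕ
coord true = proj₁
coord false = proj₂

coord-0 : ∀ k → coord k (0 , 0) ≡ 0
coord-0 true = refl
coord-0 false = refl

detour : Bool → ℕ × ℕ → Bool → ℕ
detour k item true = coord k item
detour k item false = 0

detour≤coord : ∀ k item b → detour k item b ≤ coord k item
detour≤coord k item true = ≤-refl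
detour≤coord k item false = z≤n

detour-sum : ∀ S item b → coord true item + coord false item ≤ S → detour true item b + detour false item b ≤ S * b2n b
detour-sum S item true bound = subst (_ ≤_) (sym (*-identityʳ S)) bound
detour-sum S item false bound = z≤n

bundle : ℕ → SP
bundle zero = single
bundle (suc r) = par single (bundle r)

narcs-bundle : ∀ r → narcs (bundle r) ≡ suc r
narcs-bundle zero = refl
narcs-bundle (suc r) = cong suc (narcs-bundle r)

inner-bundle : ∀ r → inner (bundle r) ≡ 0
inner-bundle zero = refl
inner-bundle (suc r) = inner-bundle r

spTail-bundle : ∀ r a → spTail (bundle r) a ≡ zero
spTail-bundle zero a = refl
spTail-bundle (suc r) zero = refl
spTail-bundle (suc r) (suc a) rewrite spTail-bundle r a = refl

spHead-bundle : ∀ r a → spHead (bundle r) a ≡ suc zero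
spHead-bundle zero a = refl
spHead-bundle (suc r) zero = refl
spHead-bundle (suc r) (suc a) rewrite spHead-bundle r a = refl

bypass : ∀ r → Fin (narcs (bundle r))
bypass zero = zero
bypass (suc r) = zero

bundleLengths : ℕ × ℕ → ∀ r → Fin (narcs (bundle r)) → ℕ × ℕ
bundleLengths item zero _ = 0 , 0
bundleLengths item (suc r) zero = 0 , 0
bundleLengths item (suc r) (suc _) = item

b2n-bypass≤count : ∀ r (δ : Fin (narcs (bundle r)) → Bool) → b2n (δ (bypass r)) ≤ count δ
b2n-bypass≤count zero δ = m≤m+n _ _
b2n-bypass≤count (suc r) δ = m≤m+n _ _

bundle-openArc : ∀ r item (δ : Fin (narcs (bundle r)) → Bool) → count δ ≤ r →
  Σ (Fin (narcs (bundle r))) λ a → δ a ≡ false × (∀ k → coord k (bundleLengths item r a) ≡ detour k item (δ (bypass r)))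
bundle-openArc zero item δ count≤0 with δ zero in eq
... | false = zero , eq , coord-0
bundle-openArc zero item δ () | true
bundle-openArc (suc r) item δ count≤r with δ zero in eq
... | false = zero , eq , coord-0
... | true with count<⇒false (λ a → δ (suc a))
                 (subst (count (λ a → δ (suc a)) <_) (sym (narcs-bundle r)) (s≤s (≤-pred count≤r)))
...   | a , δa = suc a , δa , λ k → refl

bundleWalk : ∀ r a → Walk (spGraph (bundle r)) zero (suc zero)
bundleWalk r a = snoc≡ nil a (spTail-bundle r a) (spHead-bundle r a)

walkArcs-bundleWalk : ∀ r a → walkArcs (bundleWalk r a) ≡ a ∷ []
walkArcs-bundleWalk r a = walkArcs-snoc≡ {spGraph (bundle r)} nil a (spTail-bundle r a) (spHead-bundle r a)

sinkAt : ∀ {n} → ℕ → Fin (suc n) → ℕ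
sinkAt d zero = 0
sinkAt d (suc _) = d

bundle-isPotential : ∀ k r item (δ : Fin (narcs (bundle r)) → Bool) →
  IsPotential (spGraph (bundle r)) (sinkAt (detour k item (δ (bypass r)))) (λ a → coord k (bundleLengths item r a)) δ
bundle-isPotential k r item δ a δa rewrite spTail-bundle r a | spHead-bundle r a = detour≤length r δ a δa
  where
  detour≤length : ∀ r (δ : Fin (narcs (bundle r)) → Bool) a → δ a ≡ false →
    detour k item (δ (bypass r)) ≤ coord k (bundleLengths item r a)
  detour≤length zero δ zero δa rewrite δa = z≤n
  detour≤length (suc r) δ zero δa rewrite δa = z≤n
  detour≤length (suc r) δ (suc a) _ = detour≤coord k item (δ zero)

bundle-isRank : ∀ r → IsRank (spGraph (bundle r)) (sinkAt 1)
bundle-isRank r a rewrite spTail-bundle r a | spHead-bundle r a = s≤s z≤n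

chain : ℕ → List (ℕ × ℕ) → SP
chain r [] = bundle r
chain r (item ∷ items) = ser (bundle r) (chain r items)

chainLengths : ∀ r items → Fin (narcs (chain r items)) → ℕ × ℕ
chainLengths r [] = bundleLengths (0 , 0) r
chainLengths r (item ∷ items) a = [ bundleLengths item r , chainLengths r items ]′ (splitAt (narcs (bundle r)) a)

module _ (r : ℕ) (item : ℕ × ℕ) (items : List (ℕ × ℕ)) where

  chainLengths-↑ˡ : ∀ a → chainLengths r (item ∷ items) (a ↑ˡ narcs (chain r items)) ≡ bundleLengths item r a
  chainLengths-↑ˡ a rewrite splitAt-↑ˡ (narcs (bundle r)) a (narcs (chain r items)) = refl

  chainLengths-↑ʳ : ∀ b → chainLengths r (item ∷ items) (narcs (bundle r) ↑ʳ b) ≡ chainLengths r items b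
  chainLengths-↑ʳ b rewrite splitAt-↑ʳ (narcs (bundle r)) (narcs (chain r items)) b = refl

chainDistance : Bool → ∀ r items → (Fin (narcs (chain r items)) → Bool) → ℕ
chainDistance k r [] γ = detour k (0 , 0) (γ (bypass r))
chainDistance k r (item ∷ items) γ =
  detour k item (γ (bypass r ↑ˡ narcs (chain r items))) + chainDistance k r items (λ b → γ (narcs (bundle r) ↑ʳ b))

chainDistance-cong : ∀ k r items {γ δ : Fin (narcs (chain r items)) → Bool} → (∀ a → γ a ≡ δ a) →
  chainDistance k r items γ ≡ chainDistance k r items δ
chainDistance-cong k r [] eq = cong (detour k (0 , 0)) (eq (bypass r))
chainDistance-cong k r (item ∷ items) eq = cong₂ _+_ (cong (detour k item) (eq _)) (chainDistance-cong k r items (λ b → eq _))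

chainPotential : Bool → ∀ r items → (Fin (narcs (chain r items)) → Bool) → SPV (chain r items) → ℕ
chainPotential k r [] γ = sinkAt (detour k (0 , 0) (γ (bypass r)))
chainPotential k r (item ∷ items) γ =
  Series.potential (bundle r) (chain r items)
    (sinkAt (detour k item (γ (bypass r ↑ˡ narcs (chain r items)))))
    (chainPotential k r items (λ b → γ (narcs (bundle r) ↑ʳ b)))

chainPotential-source : ∀ k r items γ → chainPotential k r items γ zero ≡ 0
chainPotential-source k r [] γ = refl
chainPotential-source k r (item ∷ items) γ = refl

chainPotential-sink : ∀ k r items γ → chainPotential k r items γ (suc zero) ≡ chainDistance k r items γ
chainPotential-sink k r [] γ = refl
chainPotential-sink k r (item ∷ items) γ =
  cong (detour k item (γ (bypass r ↑ˡ narcs (chain r items))) +_) (chainPotential-sink k r items _)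

chainPotential-isPotential : ∀ k r items γ →
  IsPotential (spGraph (chain r items)) (chainPotential k r items γ) (λ a → coord k (chainLengths r items a)) γ
chainPotential-isPotential k r [] γ = bundle-isPotential k r (0 , 0) γ
chainPotential-isPotential k r (item ∷ items) γ =
  Series.potential-isPotential (bundle r) (chain r items) _ γ (chainPotential-source k r items γʳ)
    (λ b → cong (coord k) (chainLengths-↑ˡ r item items b)) (λ b → cong (coord k) (chainLengths-↑ʳ r item items b))
    (bundle-isPotential k r item γˡ) (chainPotential-isPotential k r items γʳ)
  where
  γˡ = λ b → γ (b ↑ˡ narcs (chain r items))
  γʳ = λ b → γ (narcs (bundle r) ↑ʳ b)

chainRank : ∀ r items → SPV (chain r items) → ℕ
chainRank r [] = sinkAt 1
chainRank r (item ∷ items) = Series.potential (bundle r) (chain r items) (sinkAt 1) (chainRank r items)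

chainRank-isRank : ∀ r items → IsRank (spGraph (chain r items)) (chainRank r items)
chainRank-isRank r [] = bundle-isRank r
chainRank-isRank r (item ∷ items) =
  Series.potential-isRank (bundle r) (chain r items) (chainRank-source items) (bundle-isRank r) (chainRank-isRank r items)
  where
  chainRank-source : ∀ items → chainRank r items zero ≡ 0
  chainRank-source [] = refl
  chainRank-source (_ ∷ _) = refl

chainWalk : ∀ r items (γ : Fin (narcs (chain r items)) → Bool) → count γ ≤ r →
  Σ (Walk (spGraph (chain r items)) zero (suc zero)) λ w → All (λ a → γ a ≡ false) (walkArcs w) ×
    (∀ k → sum (map (λ a → coord k (chainLengths r items a)) (walkArcs w)) ≡ chainDistance k r items γ)
chainWalk r [] γ count≤r with bundle-openArc r (0 , 0) γ count≤r
... | a , γa , length≡ =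
  bundleWalk r a , subst (All (λ a → γ a ≡ false)) (sym (walkArcs-bundleWalk r a)) (γa ∷ []) ,
  λ k → trans (cong (λ as → sum (map (λ a → coord k (chainLengths r [] a)) as)) (walkArcs-bundleWalk r a))
              (trans (+-identityʳ _) (length≡ k))
chainWalk r (item ∷ items) γ count≤r =
  w , subst (All (λ a → γ a ≡ false)) (sym walkArcs≡) (γa ∷ All.map⁺ avoidsʳ) , length≡
  where
  open Series (bundle r) (chain r items)
  γˡ = λ b → γ (b ↑ˡ narcs (chain r items))
  γʳ = λ b → γ (narcs (bundle r) ↑ʳ b)
  count≡ = count-++ (narcs (bundle r)) (narcs (chain r items)) γ
  bundleOpen = bundle-openArc r item γˡ (≤-trans (m≤m+n _ _) (subst (_≤ r) count≡ count≤r))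
  a = proj₁ bundleOpen
  γa = proj₁ (proj₂ bundleOpen)
  restWalk = chainWalk r items γʳ (≤-trans (m≤n+m _ _) (subst (_≤ r) count≡ count≤r))
  wʳ = proj₁ restWalk
  avoidsʳ = proj₁ (proj₂ restWalk)
  w = embedL (bundleWalk r a) ++ʷ embedR wʳ
  walkArcs≡ : walkArcs w ≡ (a ↑ˡ narcs (chain r items)) ∷ map (narcs (bundle r) ↑ʳ_) (walkArcs wʳ)
  walkArcs≡ = begin
    walkArcs w                                                   ≡⟨ walkArcs-++ʷ (embedL (bundleWalk r a)) (embedR wʳ) ⟩
    walkArcs (embedL (bundleWalk r a)) ++ walkArcs (embedR wʳ)
      ≡⟨ cong₂ _++_ (walkArcs-embedL (bundleWalk r a)) (walkArcs-embedR wʳ) ⟩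
    map (_↑ˡ narcs (chain r items)) (walkArcs (bundleWalk r a)) ++ arcsʳ
      ≡⟨ cong (λ as → map (_↑ˡ narcs (chain r items)) as ++ arcsʳ) (walkArcs-bundleWalk r a) ⟩
    (a ↑ˡ narcs (chain r items)) ∷ arcsʳ ∎
    where
    open ≡-Reasoning
    arcsʳ = map (narcs (bundle r) ↑ʳ_) (walkArcs wʳ)
  length≡ : ∀ k → sum (map (λ a → coord k (chainLengths r (item ∷ items) a)) (walkArcs w))
                   ≡ chainDistance k r (item ∷ items) γ
  length≡ k = trans (cong (λ as → sum (map (λ a → coord k (chainLengths r (item ∷ items) a)) as)) walkArcs≡)
    (cong₂ _+_ (trans (cong (coord k) (chainLengths-↑ˡ r item items a)) (proj₂ (proj₂ bundleOpen) k))
               (trans (sum-map-∘ _ _ _ (λ b → cong (coord k) (chainLengths-↑ʳ r item items b)) (walkArcs wʳ))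
                      (proj₂ (proj₂ restWalk) k)))

network : ℕ → List (ℕ × ℕ) → Instance
network r items = spNetwork (chain r items) (chainLengths r items) r

module _ (k : Bool) (r : ℕ) (items : List (ℕ × ℕ)) (γ : Fin (narcs (chain r items)) → Bool) where

  private
    lengths : Fin (narcs (chain r items)) → ℕ
    lengths a = coord k (chainLengths r items a)

  chainPath : count γ ≤ r →
    Σ (Path (network r items) γ) λ P → pathLength (network r items) lengths P ≡ chainDistance k r items γ
  chainPath count≤r with chainWalk r items γ count≤r
  ... | w , avoidsγ , length≡ =
    record { walk = toNetwork w
           ; simple = increasingRank⇒unique (chainRank r items) (chainRank-isRank r items) (toNetwork w)
           ; avoids = subst (All (λ a → γ a ≡ false)) (sym walkArcs≡) avoidsγ }
    , trans (cong (λ as → sum (map lengths as)) walkArcs≡) (length≡ k)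
    where
    toNetwork = fromSpGraph (chain r items) (chainLengths r items) r
    walkArcs≡ = walkArcs-fromSpGraph (chain r items) (chainLengths r items) r w

  chainDistance≤pathLength : (P : Path (network r items) γ) → chainDistance k r items γ ≤ pathLength (network r items) lengths P
  chainDistance≤pathLength P =
    subst₂ _≤_ (chainPotential-sink k r items γ)
               (cong (_+ pathLength (network r items) lengths P) (chainPotential-source k r items γ))
      (potential-bound (chainPotential k r items γ) lengths γ (chainPotential-isPotential k r items γ) (walk P) (avoids P))

  chainDistance-isMinLength : count γ ≤ r → IsMinLength (network r items) lengths γ (just (chainDistance k r items γ))
  chainDistance-isMinLength count≤r = chainPath count≤r , chainDistance≤pathLength

Feasible-network≡ : ∀ r items (γ : Fin (narcs (chain r items)) → Bool) → Feasible (network r items) γ ≡ (count γ ≤ r)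
Feasible-network≡ r items γ = cong (λ xs → sum xs ≤ r) (tabulate-cong (λ a → *-identityˡ (b2n (γ a))))

chainDistance-sum≤ : ∀ S r items (γ : Fin (narcs (chain r items)) → Bool) →
  All (λ item → coord true item + coord false item ≤ S) items →
  chainDistance true r items γ + chainDistance false r items γ ≤ S * count γ
chainDistance-sum≤ S r [] γ [] = ≤-trans (detour-sum S (0 , 0) (γ (bypass r)) z≤n) (*-monoʳ-≤ S (b2n-bypass≤count r γ))
chainDistance-sum≤ S r (item ∷ items) γ (bounded ∷ boundeds) = begin
  (detour true item b + chainDistance true r items γʳ) + (detour false item b + chainDistance false r items γʳ)
    ≡⟨ interchange (detour true item b) _ _ _ ⟩
  (detour true item b + detour false item b) + (chainDistance true r items γʳ + chainDistance false r items γʳ)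
    ≤⟨ +-mono-≤ (detour-sum S item b bounded) (chainDistance-sum≤ S r items γʳ boundeds) ⟩
  S * b2n b + S * count γʳ                ≡⟨ *-distribˡ-+ S (b2n b) (count γʳ) ⟨
  S * (b2n b + count γʳ)                  ≤⟨ *-monoʳ-≤ S (+-monoˡ-≤ (count γʳ) (b2n-bypass≤count r γˡ)) ⟩
  S * (count γˡ + count γʳ)               ≡⟨ cong (S *_) (count-++ (narcs (bundle r)) (narcs (chain r items)) γ) ⟨
  S * count γ                             ∎
  where
  open ≤-Reasoning
  γˡ = λ b → γ (b ↑ˡ narcs (chain r items))
  γʳ = λ b → γ (narcs (bundle r) ↑ʳ b)
  b = γˡ (bypass r)

chain-efficient : ∀ S r items (γ : Fin (narcs (chain r items)) → Bool) →
  All (λ item → coord true item + coord false item ≤ S) items → count γ ≤ r →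
  chainDistance true r items γ + chainDistance false r items γ ≡ S * r → Efficient (network r items) γ
chain-efficient S r items γ boundeds count≤r sum≡ = subst id (sym (Feasible-network≡ r items γ)) count≤r , undominated
  where
  I = network r items
  objVal≡ : ∀ γ' → count γ' ≤ r → ∀ {y} → ObjVal I γ' y →
    y ≡ (just (chainDistance true r items γ') , just (chainDistance false r items γ'))
  objVal≡ γ' count≤r {y₁ , y₂} (min₁ , min₂) =
    cong₂ _,_ (IsMinLength-functional I _ γ' min₁ (chainDistance-isMinLength true r items γ' count≤r))
              (IsMinLength-functional I _ γ' min₂ (chainDistance-isMinLength false r items γ' count≤r))
  undominated : (γ' : Strategy I) → Feasible I γ' → ∀ y y' → ObjVal I γ y → ObjVal I γ' y' → ¬ (y' ≥P y)
  undominated γ' feasible = undominated-count γ' (subst id (Feasible-network≡ r items γ') feasible)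
    where
    undominated-count : ∀ γ' → count γ' ≤ r → ∀ y y' → ObjVal I γ y → ObjVal I γ' y' → ¬ (y' ≥P y)
    undominated-count γ' count'≤r y y' objVal objVal' rewrite objVal≡ γ count≤r objVal | objVal≡ γ' count'≤r objVal' =
      maxSum-undominated (≤-trans (chainDistance-sum≤ S r items γ' boundeds) (*-monoʳ-≤ S count'≤r)) sum≡

bypassOnly : ∀ r → Bool → Fin (narcs (bundle r)) → Bool
bypassOnly zero b _ = b
bypassOnly (suc r) b zero = b
bypassOnly (suc r) b (suc _) = false

bypassOnly-bypass : ∀ r b → bypassOnly r b (bypass r) ≡ b
bypassOnly-bypass zero b = refl
bypassOnly-bypass (suc r) b = refl

count-bypassOnly : ∀ r b → count (bypassOnly r b) ≡ b2n b
count-bypassOnly zero b = +-identityʳ _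
count-bypassOnly (suc r) b = trans (cong (b2n b +_) (count-false (narcs (bundle r)))) (+-identityʳ _)

module _ (r : ℕ) (item : ℕ × ℕ) (items : List (ℕ × ℕ)) where

  prepend : Bool → (Fin (narcs (chain r items)) → Bool) → Fin (narcs (chain r (item ∷ items))) → Bool
  prepend b δ a = [ bypassOnly r b , δ ]′ (splitAt (narcs (bundle r)) a)

  prepend-↑ˡ : ∀ b δ a → prepend b δ (a ↑ˡ narcs (chain r items)) ≡ bypassOnly r b a
  prepend-↑ˡ b δ a rewrite splitAt-↑ˡ (narcs (bundle r)) a (narcs (chain r items)) = refl

  prepend-↑ʳ : ∀ b δ a → prepend b δ (narcs (bundle r) ↑ʳ a) ≡ δ a
  prepend-↑ʳ b δ a rewrite splitAt-↑ʳ (narcs (bundle r)) (narcs (chain r items)) a = refl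

  chainDistance-prepend : ∀ k b δ → chainDistance k r (item ∷ items) (prepend b δ) ≡ detour k item b + chainDistance k r items δ
  chainDistance-prepend k b δ =
    cong₂ _+_ (cong (detour k item) (trans (prepend-↑ˡ b δ (bypass r)) (bypassOnly-bypass r b)))
              (chainDistance-cong k r items (prepend-↑ʳ b δ))

  count-prepend : ∀ b δ → count (prepend b δ) ≡ b2n b + count δ
  count-prepend b δ =
    trans (count-++ (narcs (bundle r)) (narcs (chain r items)) (prepend b δ))
          (cong₂ _+_ (trans (count-cong (prepend-↑ˡ b δ)) (count-bypassOnly r b)) (count-cong (prepend-↑ʳ b δ)))

bitItems : ℕ → ℕ → List (ℕ × ℕ)
bitItems T zero = []
bitItems T (suc p) = (2 ^ p , T ∸ 2 ^ p) ∷ (0 , T) ∷ bitItems T p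

bitItems-bounded : ∀ n p → p ≤ n → All (λ item → coord true item + coord false item ≤ 2 ^ n) (bitItems (2 ^ n) p)
bitItems-bounded n zero _ = []
bitItems-bounded n (suc p) p<n =
  ≤-reflexive (m+[n∸m]≡n (^-monoʳ-≤ 2 (<⇒≤ p<n))) ∷ ≤-refl ∷ bitItems-bounded n p (<⇒≤ p<n)

withBit : ∀ r T p → Bool → (Fin (narcs (chain r (bitItems T p))) → Bool) → Fin (narcs (chain r (bitItems T (suc p)))) → Bool
withBit r T p bit δ = prepend r (2 ^ p , T ∸ 2 ^ p) ((0 , T) ∷ bitItems T p) bit (prepend r (0 , T) (bitItems T p) (not bit) δ)

bitStrategy : ∀ r T p → ℕ → Fin (narcs (chain r (bitItems T p))) → Bool
bitStrategy r T zero k _ = false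
bitStrategy r T (suc p) k with k <? 2 ^ p
... | yes _ = withBit r T p false (bitStrategy r T p k)
... | no _ = withBit r T p true (bitStrategy r T p (k ∸ 2 ^ p))

module _ (r T p : ℕ) (bit : Bool) (δ : Fin (narcs (chain r (bitItems T p))) → Bool) where

  private
    high low : ℕ × ℕ
    high = 2 ^ p , T ∸ 2 ^ p
    low = 0 , T

  count-withBit : count (withBit r T p bit δ) ≡ suc (count δ)
  count-withBit = begin
    count (withBit r T p bit δ)                           ≡⟨ count-prepend r high (low ∷ bitItems T p) bit _ ⟩
    b2n bit + count (prepend r low (bitItems T p) (not bit) δ)
      ≡⟨ cong (b2n bit +_) (count-prepend r low (bitItems T p) (not bit) δ) ⟩
    b2n bit + (b2n (not bit) + count δ)      ≡⟨ +-assoc (b2n bit) _ _ ⟨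
    b2n bit + b2n (not bit) + count δ        ≡⟨ cong (_+ count δ) (one-of bit) ⟩
    suc (count δ)                            ∎
    where
    open ≡-Reasoning
    one-of : ∀ b → b2n b + b2n (not b) ≡ 1
    one-of true = refl
    one-of false = refl

  chainDistance-withBit : ∀ k → chainDistance k r (bitItems T (suc p)) (withBit r T p bit δ)
    ≡ detour k (2 ^ p , T ∸ 2 ^ p) bit + (detour k (0 , T) (not bit) + chainDistance k r (bitItems T p) δ)
  chainDistance-withBit k =
    trans (chainDistance-prepend r high (low ∷ bitItems T p) k bit _)
          (cong (detour k high bit +_) (chainDistance-prepend r low (bitItems T p) k (not bit) δ))

bitStrategy-distances : ∀ r n p k → p ≤ n → k < 2 ^ p →
  count (bitStrategy r (2 ^ n) p k) ≡ p ×
  chainDistance true r (bitItems (2 ^ n) p) (bitStrategy r (2 ^ n) p k) ≡ k ×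
  chainDistance false r (bitItems (2 ^ n) p) (bitStrategy r (2 ^ n) p k) + k ≡ p * 2 ^ n
bitStrategy-distances r n zero zero _ _ = count-false (narcs (bundle r)) , refl , refl
bitStrategy-distances r n zero (suc k) _ (s≤s ())
bitStrategy-distances r n (suc p) k p<n k<2^[1+p] with k <? 2 ^ p
... | yes k<2^p
  rewrite count-withBit r (2 ^ n) p false (bitStrategy r (2 ^ n) p k)
        | chainDistance-withBit r (2 ^ n) p false (bitStrategy r (2 ^ n) p k) true
        | chainDistance-withBit r (2 ^ n) p false (bitStrategy r (2 ^ n) p k) false =
  let (count≡ , true≡ , false≡) = bitStrategy-distances r n p k (<⇒≤ p<n) k<2^p
  in cong suc count≡ , true≡ , trans (+-assoc (2 ^ n) _ k) (cong (2 ^ n +_) false≡)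
... | no k≮2^p
  rewrite count-withBit r (2 ^ n) p true (bitStrategy r (2 ^ n) p (k ∸ 2 ^ p))
        | chainDistance-withBit r (2 ^ n) p true (bitStrategy r (2 ^ n) p (k ∸ 2 ^ p)) true
        | chainDistance-withBit r (2 ^ n) p true (bitStrategy r (2 ^ n) p (k ∸ 2 ^ p)) false =
  let (count≡ , true≡ , false≡) = bitStrategy-distances r n p (k ∸ 2 ^ p) (<⇒≤ p<n) k∸2^p<2^p
  in cong suc count≡ , trans (cong (2 ^ p +_) true≡) 2^p+[k∸2^p]≡k , false-total false≡
  where
  2^p≤k = ≮⇒≥ k≮2^p
  2^p+[k∸2^p]≡k = m+[n∸m]≡n 2^p≤k
  k∸2^p<2^p : k ∸ 2 ^ p < 2 ^ p
  k∸2^p<2^p = +-cancelˡ-< (2 ^ p) (k ∸ 2 ^ p) (2 ^ p)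
    (subst (_< 2 ^ p + 2 ^ p) (sym 2^p+[k∸2^p]≡k) (subst (k <_) (cong (2 ^ p +_) (+-identityʳ (2 ^ p))) k<2^[1+p]))
  false-total : ∀ {d} → d + (k ∸ 2 ^ p) ≡ p * 2 ^ n → (2 ^ n ∸ 2 ^ p) + d + k ≡ 2 ^ n + p * 2 ^ n
  false-total {d} d+k'≡ = begin
    (2 ^ n ∸ 2 ^ p) + d + k                         ≡⟨ cong ((2 ^ n ∸ 2 ^ p) + d +_) 2^p+[k∸2^p]≡k ⟨
    (2 ^ n ∸ 2 ^ p) + d + (2 ^ p + (k ∸ 2 ^ p))     ≡⟨ interchange (2 ^ n ∸ 2 ^ p) d (2 ^ p) (k ∸ 2 ^ p) ⟩
    (2 ^ n ∸ 2 ^ p) + 2 ^ p + (d + (k ∸ 2 ^ p))     ≡⟨ cong₂ _+_ (m∸n+n≡m (^-monoʳ-≤ 2 (<⇒≤ p<n))) d+k'≡ ⟩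
    2 ^ n + p * 2 ^ n                               ∎
    where open ≡-Reasoning

inner-chain : ∀ r items → inner (chain r items) ≡ length items
inner-chain r [] = inner-bundle r
inner-chain r (item ∷ items) = cong suc (cong₂ _+_ (inner-bundle r) (inner-chain r items))

narcs-chain : ∀ r items → narcs (chain r items) ≡ suc (length items) * suc r
narcs-chain r [] = trans (narcs-bundle r) (sym (+-identityʳ _))
narcs-chain r (item ∷ items) = cong₂ _+_ (narcs-bundle r) (narcs-chain r items)

length-bitItems : ∀ T p → length (bitItems T p) ≡ p + p
length-bitItems T zero = refl
length-bitItems T (suc p) = cong suc (trans (cong suc (length-bitItems T p)) (sym (+-suc p p)))

coord≤sum : ∀ k item → coord k item ≤ coord true item + coord false item
coord≤sum true item = m≤m+n _ _
coord≤sum false item = m≤n+m _ _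

coord-bundleLengths≤ : ∀ k item r a → coord k (bundleLengths item r a) ≤ coord k item
coord-bundleLengths≤ k item zero a rewrite coord-0 k = z≤n
coord-bundleLengths≤ k item (suc r) zero rewrite coord-0 k = z≤n
coord-bundleLengths≤ k item (suc r) (suc a) = ≤-refl

chainLengths-bounded : ∀ S r items → All (λ item → coord true item + coord false item ≤ S) items →
  ∀ k a → coord k (chainLengths r items a) ≤ S
chainLengths-bounded S r [] [] k a = ≤-trans (coord-bundleLengths≤ k (0 , 0) r a) (subst (_≤ S) (sym (coord-0 k)) z≤n)
chainLengths-bounded S r (item ∷ items) (bounded ∷ boundeds) k = ↑-elim _
  (λ a → subst (λ l → coord k l ≤ S) (sym (chainLengths-↑ˡ r item items a))
               (≤-trans (coord-bundleLengths≤ k item r a) (≤-trans (coord≤sum k item) bounded)))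
  (λ b → subst (λ l → coord k l ≤ S) (sym (chainLengths-↑ʳ r item items b)) (chainLengths-bounded S r items boundeds k b))

bitLength≤ : ∀ n {x} → x ≤ 2 ^ n → bitLength x ≤ suc n
bitLength≤ n {x} x≤2^n = s≤s (subst (⌊log₂ x ⌋ ≤_) (⌊log₂[2^n]⌋≡n n) (⌊log₂⌋-mono-≤ x≤2^n))

n≤2^n : ∀ n → n ≤ 2 ^ n
n≤2^n zero = z≤n
n≤2^n (suc n) = subst (suc n ≤_) (cong (2 ^ n +_) (sym (+-identityʳ (2 ^ n)))) (+-mono-≤ (m^n>0 2 n) (n≤2^n n))

sum-tabulate≤ : ∀ {m} (f : Fin m → ℕ) c → (∀ a → f a ≤ c) → sum (tabulate f) ≤ m * c
sum-tabulate≤ {zero} f c f≤c = z≤n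
sum-tabulate≤ {suc m} f c f≤c = +-mono-≤ (f≤c zero) (sum-tabulate≤ (λ a → f (suc a)) c (λ a → f≤c (suc a)))

hardInstance : ℕ → Instance
hardInstance n = network n (bitItems (2 ^ n) n)

hardInstance-nonDominated : ∀ n k → k < 2 ^ n → NonDominated (hardInstance n) (just k , just (n * 2 ^ n ∸ k))
hardInstance-nonDominated n k k<2^n =
  γ , chain-efficient (2 ^ n) n items γ (bitItems-bounded n n ≤-refl) (≤-reflexive count≡) total≡
    , subst (IsMinLength (hardInstance n) (l¹ (hardInstance n)) γ) (cong just true≡)
            (chainDistance-isMinLength true n items γ count≤n)
    , subst (IsMinLength (hardInstance n) (l² (hardInstance n)) γ) (cong just false≡)
            (chainDistance-isMinLength false n items γ count≤n)
  where
  items = bitItems (2 ^ n) n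
  γ = bitStrategy n (2 ^ n) n k
  distances = bitStrategy-distances n n n k ≤-refl k<2^n
  count≡ = proj₁ distances
  count≤n = ≤-reflexive count≡
  true≡ = proj₁ (proj₂ distances)
  false+k≡ = proj₂ (proj₂ distances)
  false≡ : chainDistance false n items γ ≡ n * 2 ^ n ∸ k
  false≡ = trans (sym (m+n∸n≡m _ k)) (cong (_∸ k) false+k≡)
  total≡ : chainDistance true n items γ + chainDistance false n items γ ≡ 2 ^ n * n
  total≡ = trans (cong (_+ chainDistance false n items γ) true≡) (trans (+-comm k _) (trans false+k≡ (*-comm n (2 ^ n))))

hardInstance-atLeast : ∀ n → AtLeastNonDominated (hardInstance n) (2 ^ n)
hardInstance-atLeast n =
  applyUpTo point (2 ^ n)
  , Unique.applyUpTo⁺₁ point (2 ^ n) (λ i<j _ eq → <⇒≢ i<j (just-injective (cong proj₁ eq)))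
  , All.applyUpTo⁺₁ point (2 ^ n) (hardInstance-nonDominated n _)
  , ≤-reflexive (sym (length-applyUpTo point (2 ^ n)))
  where
  point : ℕ → Point
  point k = just k , just (n * 2 ^ n ∸ k)

hardInstance-isSeriesParallel : ∀ n → IsSeriesParallel (hardInstance n)
hardInstance-isSeriesParallel n =
  chain n (bitItems (2 ^ n) n) , id , id , id-bijective , id-bijective , refl , refl , λ a → refl , refl
  where
  id-bijective : ∀ {A : Set} → Bijective _≡_ _≡_ (id {A = A})
  id-bijective = (λ eq → eq) , λ y → y , λ eq → eq

cubic-bound : ∀ n → let N = suc n in
  (N + N) + (N + N) * N + (N + N) * N * (N + N + N) + N ≤ 11 * N ^ 3
cubic-bound n = begin
  (N + N) + (N + N) * N + (N + N) * N * (N + N + N) + N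
    ≡⟨ solve 1 (λ N → (N :+ N) :+ (N :+ N) :* N :+ (N :+ N) :* N :* (N :+ N :+ N) :+ N
                   := con 3 :* N :^ 1 :+ con 2 :* N :^ 2 :+ con 6 :* N :^ 3) refl N ⟩
  3 * N ^ 1 + 2 * N ^ 2 + 6 * N ^ 3
    ≤⟨ +-monoˡ-≤ (6 * N ^ 3) (+-mono-≤ (*-monoʳ-≤ 3 (^-monoʳ-≤ N {1} {3} (s≤s z≤n)))
                                      (*-monoʳ-≤ 2 (^-monoʳ-≤ N {2} {3} (s≤s (s≤s z≤n))))) ⟩
  3 * N ^ 3 + 2 * N ^ 3 + 6 * N ^ 3
    ≡⟨ solve 1 (λ M → con 3 :* M :+ con 2 :* M :+ con 6 :* M := con 11 :* M) refl (N ^ 3) ⟩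
  11 * N ^ 3 ∎
  where
  N = suc n
  open ≤-Reasoning

hardInstance-size : ∀ n → size (hardInstance n) ≤ 11 * suc n ^ 3
hardInstance-size n = ≤-trans (+-mono-≤ (+-mono-≤ (+-mono-≤ nV≤ m≤) arcBits≤) (bitLength≤ n (n≤2^n n))) (cubic-bound n)
  where
  N = suc n
  I = hardInstance n
  items = bitItems (2 ^ n) n
  nV≤ : nV I ≤ N + N
  nV≤ = ≤-reflexive (trans (cong (2 +_) (trans (inner-chain n items) (length-bitItems (2 ^ n) n))) (cong suc (sym (+-suc n n))))
  m≤ : m I ≤ (N + N) * N
  m≤ = subst (_≤ (N + N) * N) (sym (trans (narcs-chain n items) (cong (λ l → suc l * N) (length-bitItems (2 ^ n) n))))
             (*-monoˡ-≤ N (≤-trans (n≤1+n _) (≤-reflexive (cong suc (sym (+-suc n n))))))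
  lengthBits≤ : ∀ k a → bitLength (coord k (chainLengths n items a)) ≤ N
  lengthBits≤ k a = bitLength≤ n (chainLengths-bounded (2 ^ n) n items (bitItems-bounded n n ≤-refl) k a)
  arcBits≤ : sumA I (λ a → bitLength (l¹ I a) + bitLength (l² I a) + bitLength (c I a)) ≤ (N + N) * N * (N + N + N)
  arcBits≤ = ≤-trans (sum-tabulate≤ _ (N + N + N)
                       (λ a → +-mono-≤ (+-mono-≤ (lengthBits≤ true a) (lengthBits≤ false a)) (bitLength≤ n (m^n>0 2 n))))
                     (*-monoˡ-≤ (N + N + N) m≤)

theorem2 : Σ ℕ λ C → Σ ℕ λ k → (n : ℕ) → Σ Instance λ I → IsSeriesParallel I × UnitCosts I × size I ≤ C * suc n ^ k × AtLeastNonDominated I (2 ^ n)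
theorem2 = 11 , 3 , λ n →
  hardInstance n , hardInstance-isSeriesParallel n , (λ _ → refl) , hardInstance-size n , hardInstance-atLeast n
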